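{- Let $q$ be a power of an odd prime and let $G$ be a connected labeled graph over $\mathbf{F}_q$ on $\{1,\dots,n\}$ with $n\ge3$. Let $\phi_i=(X_i,Y_i,-Y_i,T_i)\in\Lambda_0^0(G,G)$ for $i=1,2$ and $\psi=(U,V,-V,W)\in\Lambda_0^0(G,G)$. Suppose $\Psi(\phi_1,\phi_2)=aI$ for some nonzero $a\in\mathbf{F}_q$ and $\Psi(\phi_1,\psi)=0$. Then $\mathrm{supp}(U)\subseteq\mathrm{supp}(X_1)$, i.e. every vertex $k$ with $U(k)\ne0$ has $X_1(k)\ne0$.
   Context: A labeled graph is a symmetric matrix $G=(g_{ij})$ over $\mathbf{F}_q$ with zero diagonal; $ij$ is an edge iff $g_{ij}\ne0$. Neighborhood function $g(i)=(g_{i1},\dots,g_{in})$; $e_i$ standard basis vectors; $I$ all-ones vector; $\times$ coordinatewise product; $\langle u,v\rangle=\sum_ku_kv_k$. $\Lambda(G,G)$ is the set of $(X,Y,Z,T)\in(\mathbf{F}_q^n)^4$ with $\langle X,g(i)\times g(j)\rangle-\langle Y,g(i)\times e_j\rangle+\langle Z,e_i\times g(j)\rangle-\langle T,e_i\times e_j\rangle=0$ for all $i,j$. $\Lambda_0(G,G)=\{(X,Y,Z,T)\in\Lambda(G,G):Y+Z=0\}$; $\det(X,Y,Z,T)=Y\times Z-X\times T$; $\Lambda_0^0(G,G)=\{\phi\in\Lambda_0(G,G):\det\phi=0\}$. For $\phi=(X,Y,-Y,T),\phi'=(X',Y',-Y',T')\in\Lambda_0(G,G)$, $\Psi(\phi,\phi')=2Y\times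 Y'+X\times T'+X'\times T$. -}

module Defs where

open import Level using (0ℓ)
open import Algebra.Bundles using (CommutativeRing)
open import Data.Nat as ℕ using (ℕ; zero; suc; _^_; _≥_)
open import Data.Nat.Primality using (Prime)
open import Data.Fin as Fin using (Fin)
open import Data.Product using (Σ; ∃; _×_; _,_; proj₁; proj₂)
open import Relation.Nullary using (¬_; yes; no)
open import Relation.Binary.PropositionalEquality using (_≡_; _≢_)

record Field : Set₁ where
  field
    cring : CommutativeRing 0ℓ 0ℓ
  open CommutativeRing cring public
  field
    1≉0     : ¬ (1# ≈ 0#)
    inverse : ∀ x → ¬ (x ≈ 0#) → ∃ λ y → x * y ≈ 1#

record FiniteField (q : ℕ) : Set₁ where
  field
    fld      : Field
  open Field fld public
  field
    enum     : Fin q → Carrier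
    enum-sur : ∀ x → ∃ λ i → enum i ≈ x
    enum-inj : ∀ i j → enum i ≈ enum j → i ≡ j

OddPrimePower : ℕ → Set
OddPrimePower q = ∃ λ p → ∃ λ k → Prime p × p ≢ 2 × k ≥ 1 × q ≡ p ^ k

module Over (F : Field) where
  open Field F

  Vect : ℕ → Set
  Vect n = Fin n → Carrier

  _≋_ : ∀ {n} → Vect n → Vect n → Set
  u ≋ v = ∀ k → u k ≈ v k

  zeroV : ∀ {n} → Vect n
  zeroV _ = 0#

  e : ∀ {n} → Fin n → Vect n
  e i k with i Fin.≟ k
  ... | yes _ = 1#
  ... | no  _ = 0#

  I : ∀ {n} → Vect n
  I _ = 1#

  _·ᵥ_ : ∀ {n} → Carrier → Vect n → Vect n
  (a ·ᵥ u) k = a * u k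

  _⊗_ : ∀ {n} → Vect n → Vect n → Vect n
  (u ⊗ v) k = u k * v k

  _⊕_ : ∀ {n} → Vect n → Vect n → Vect n
  (u ⊕ v) k = u k + v k

  ⊖_ : ∀ {n} → Vect n → Vect n
  (⊖ u) k = - (u k)

  Σᶠ : ∀ {n} → Vect n → Carrier
  Σᶠ {zero}  u = 0#
  Σᶠ {suc n} u = u Fin.zero + Σᶠ {n} (λ k → u (Fin.suc k))

  ⟨_,_⟩ : ∀ {n} → Vect n → Vect n → Carrier
  ⟨ u , v ⟩ = Σᶠ (u ⊗ v)

  supp : ∀ {n} → Vect n → Fin n → Set
  supp u k = ¬ (u k ≈ 0#)

  record LabeledGraph (n : ℕ) : Set where
    field
      g    : Fin n → Fin n → Carrier
      sym  : ∀ i j → g i j ≈ g j i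
      diag : ∀ i → g i i ≈ 0#

  module _ {n : ℕ} (G : LabeledGraph n) where
    open LabeledGraph G

    Edge : Fin n → Fin n → Set
    Edge i j = ¬ (g i j ≈ 0#)

    data Walk : Fin n → Fin n → Set where
      [] : ∀ {i} → Walk i i
      _∷_ : ∀ {i j k} → Edge i j → Walk j k → Walk i k

    Connected : Set
    Connected = ∀ i j → Walk i j

    nb : Fin n → Vect n
    nb i = g i

  Quad : ℕ → Set
  Quad n = Vect n × Vect n × Vect n × Vect n

  module _ {n : ℕ} (G : LabeledGraph n) where
    open LabeledGraph G

    InΛ : Quad n → Set
    InΛ (X , Y , Z , T) = ∀ i j →
      ((⟨ X , g i ⊗ g j ⟩ - ⟨ Y , g i ⊗ e j ⟩) + ⟨ Z , e i ⊗ g j ⟩)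
        - ⟨ T , e i ⊗ e j ⟩ ≈ 0#

    InΛ₀ : Quad n → Set
    InΛ₀ φ@(X , Y , Z , T) = InΛ φ × ((Y ⊕ Z) ≋ zeroV)

  det : ∀ {n} → Quad n → Vect n
  det (X , Y , Z , T) = (Y ⊗ Z) ⊕ (⊖ (X ⊗ T))

  InΛ₀⁰ : ∀ {n} → LabeledGraph n → Quad n → Set
  InΛ₀⁰ G φ = InΛ₀ G φ × (det φ ≋ zeroV)

  -- Ψ(φ,φ') = 2 Y×Y' + X×T' + X'×T   (for φ = (X,Y,-Y,T), φ' = (X',Y',-Y',T'))
  Ψ : ∀ {n} → Quad n → Quad n → Vect n
  Ψ (X , Y , _ , T) (X' , Y' , _ , T') =
    (((1# + 1#) ·ᵥ (Y ⊗ Y')) ⊕ (X ⊗ T')) ⊕ (X' ⊗ T)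

{-# OPTIONS --safe #-}
-- The argument is pointwise at the vertex k, and only the determinant condition on φ₁ is
-- needed. If X₁(k) = 0, then det φ₁ = 0 reads −Y₁(k)² = 0, so Y₁(k) = 0. The k-th entry of
-- Ψ(φ₁, φ') then collapses to X'(k) T₁(k) for every φ'. For φ' = ψ it vanishes while
-- U(k) ≠ 0, so T₁(k) = 0; but then the k-th entry of Ψ(φ₁, φ₂), which is a, vanishes too.
module Submission where

open import Defs
open import Data.Nat using (ℕ; _≥_)
open import Data.Fin using (Fin)
open import Data.Product using (_,_)
open import Function using (_∘_)
open import Relation.Nullary using (¬_)
import Algebra.Properties.Ring as RingProperties
import Relation.Binary.Reasoning.Setoid as SetoidReasoning

module FieldProperties (F : Field) where
  open Field F
  open RingProperties ring using (-0#≈0#; -‿injective)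
  open SetoidReasoning setoid

  x≉0∧xy≈0⇒y≈0 : ∀ {x y} → ¬ x ≈ 0# → x * y ≈ 0# → y ≈ 0#
  x≉0∧xy≈0⇒y≈0 {x} {y} x≉0 xy≈0 with inverse x x≉0
  ... | x⁻¹ , xx⁻¹≈1 = begin
    y              ≈⟨ *-identityˡ y ⟨
    1# * y         ≈⟨ *-congʳ xx⁻¹≈1 ⟨
    (x * x⁻¹) * y  ≈⟨ *-congʳ (*-comm x x⁻¹) ⟩
    (x⁻¹ * x) * y  ≈⟨ *-assoc x⁻¹ x y ⟩
    x⁻¹ * (x * y)  ≈⟨ *-congˡ xy≈0 ⟩
    x⁻¹ * 0#       ≈⟨ zeroʳ x⁻¹ ⟩
    0#             ∎

  -- _≈_ is not assumed decidable, so constructively only the double negation follows.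
  x*-x≈0⇒¬¬x≈0 : ∀ {x} → x * - x ≈ 0# → ¬ ¬ (x ≈ 0#)
  x*-x≈0⇒¬¬x≈0 x*-x≈0 x≉0 =
    x≉0 (-‿injective (trans (x≉0∧xy≈0⇒y≈0 x≉0 x*-x≈0) (sym -0#≈0#)))

module Pointwise (F : Field) where
  open Field F
  open Over F
  open FieldProperties F
  open RingProperties ring using (-0#≈0#)
  open SetoidReasoning setoid

  X≈0∧det≈0⇒¬¬Y≈0 : ∀ {n} (X Y T : Vect n) → det (X , Y , ⊖ Y , T) ≋ zeroV →
                    ∀ k → X k ≈ 0# → ¬ ¬ (Y k ≈ 0#)
  X≈0∧det≈0⇒¬¬Y≈0 X Y T det≋0 k Xk≈0 = x*-x≈0⇒¬¬x≈0 (begin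
    Y k * - Y k                    ≈⟨ +-identityʳ _ ⟨
    Y k * - Y k + 0#               ≈⟨ +-congˡ XkTk≈0 ⟨
    Y k * - Y k + - (X k * T k)    ≈⟨ det≋0 k ⟩
    0#                             ∎)
    where
    XkTk≈0 : - (X k * T k) ≈ 0#
    XkTk≈0 = trans (-‿cong (trans (*-congʳ Xk≈0) (zeroˡ (T k)))) -0#≈0#

  X≈0∧Y≈0⇒Ψ≈X'T : ∀ {n} (X Y Z T X' Y' Z' T' : Vect n) k → X k ≈ 0# → Y k ≈ 0# →
                  Ψ (X , Y , Z , T) (X' , Y' , Z' , T') k ≈ X' k * T k
  X≈0∧Y≈0⇒Ψ≈X'T X Y Z T X' Y' Z' T' k Xk≈0 Yk≈0 = begin
    ((1# + 1#) * (Y k * Y' k) + X k * T' k) + X' k * T k  ≈⟨ +-congʳ (+-cong 2YY'≈0 XT'≈0) ⟩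
    (0# + 0#) + X' k * T k                                ≈⟨ +-congʳ (+-identityˡ 0#) ⟩
    0# + X' k * T k                                       ≈⟨ +-identityˡ _ ⟩
    X' k * T k                                            ∎
    where
    2YY'≈0 : (1# + 1#) * (Y k * Y' k) ≈ 0#
    2YY'≈0 = trans (*-congˡ (trans (*-congʳ Yk≈0) (zeroˡ (Y' k)))) (zeroʳ _)
    XT'≈0 : X k * T' k ≈ 0#
    XT'≈0 = trans (*-congʳ Xk≈0) (zeroˡ (T' k))

mainTheorem11 : (q : ℕ) → OddPrimePower q → (F : FiniteField q) →
    let open FiniteField F in
    let open Over fld in
    (n : ℕ) → n ≥ 3 → (G : LabeledGraph n) → Connected G →
    (X₁ Y₁ T₁ X₂ Y₂ T₂ U V W : Vect n) →
    InΛ₀⁰ G (X₁ , Y₁ , ⊖ Y₁ , T₁) →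
    InΛ₀⁰ G (X₂ , Y₂ , ⊖ Y₂ , T₂) →
    InΛ₀⁰ G (U , V , ⊖ V , W) →
    (a : Carrier) → ¬ (a ≈ 0#) →
    Ψ (X₁ , Y₁ , ⊖ Y₁ , T₁) (X₂ , Y₂ , ⊖ Y₂ , T₂) ≋ (a ·ᵥ I) →
    Ψ (X₁ , Y₁ , ⊖ Y₁ , T₁) (U , V , ⊖ V , W) ≋ zeroV →
    (k : Fin n) → ¬ (U k ≈ 0#) → ¬ (X₁ k ≈ 0#)
mainTheorem11 _ _ F _ _ _ _ X₁ Y₁ T₁ X₂ Y₂ T₂ U V W (_ , det₁≋0) _ _
              a a≉0 Ψ₁₂≋aI Ψ₁ψ≋0 k Uk≉0 X₁k≈0 =
  X≈0∧det≈0⇒¬¬Y≈0 X₁ Y₁ T₁ det₁≋0 k X₁k≈0 (a≉0 ∘ a≈0)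
  where
  open FiniteField F
  open Over fld
  open FieldProperties fld
  open Pointwise fld
  open SetoidReasoning setoid

  Ψ₁≈X'T₁ : Y₁ k ≈ 0# → ∀ X' Y' T' → Ψ (X₁ , Y₁ , ⊖ Y₁ , T₁) (X' , Y' , ⊖ Y' , T') k ≈ X' k * T₁ k
  Ψ₁≈X'T₁ Y₁k≈0 X' Y' T' = X≈0∧Y≈0⇒Ψ≈X'T X₁ Y₁ (⊖ Y₁) T₁ X' Y' (⊖ Y') T' k X₁k≈0 Y₁k≈0

  T₁k≈0 : Y₁ k ≈ 0# → T₁ k ≈ 0#
  T₁k≈0 Y₁k≈0 = x≉0∧xy≈0⇒y≈0 Uk≉0 (trans (sym (Ψ₁≈X'T₁ Y₁k≈0 U V W)) (Ψ₁ψ≋0 k))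

  a≈0 : Y₁ k ≈ 0# → a ≈ 0#
  a≈0 Y₁k≈0 = begin
    a            ≈⟨ *-identityʳ a ⟨
    a * 1#       ≈⟨ trans (sym (Ψ₁₂≋aI k)) (Ψ₁≈X'T₁ Y₁k≈0 X₂ Y₂ T₂) ⟩
    X₂ k * T₁ k  ≈⟨ *-congˡ (T₁k≈0 Y₁k≈0) ⟩
    X₂ k * 0#    ≈⟨ zeroʳ (X₂ k) ⟩
    0#           ∎
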